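{- Fix integers $c,d$ with $0\le c<d$ and $\gcd(c,d)=1$. For positive integers $n,m$ with $m\mid n$ let $$A(n,m)=\#\left\{(r,j):\ r\mid n,\ 0\le j\le r-1,\ m=\gcd\!\left(\tfrac nr c+jd,\ rd\right)\right\}$$ ($r$ ranging over positive divisors of $n$). Let $n,m$ be positive integers with $m\mid n$, and suppose $n=n_1n_2$ with positive integers $n_1,n_2$ satisfying $\gcd(n_1,n_2)=1$. Put $m_1=\gcd(m,n_1)$ and $m_2=\gcd(m,n_2)$. Then $$A(n,m)=A(n_1,m_1)\,A(n_2,m_2).$$ -}

module Defs where

open import Data.Nat using (ℕ; suc; _+_; _*_; _/_; _<_; _≟_)
open import Data.Nat.Divisibility using (_∣_; _∣?_)
open import Data.Nat.GCD using (gcd)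
open import Data.List using (List; length; filter; upTo; map)
open import Data.Nat.ListAction using (sum)

countJ : (c d n m r' : ℕ) → ℕ
countJ c d n m r' =
  length (filter (λ j → m ≟ gcd ((n / suc r') * c + j * d) (suc r' * d)) (upTo (suc r')))

-- A(n,m) = #{(r,j) : r ∣ n, r ≥ 1, 0 ≤ j ≤ r-1, m = gcd((n/r)c + jd, rd)}.
-- r ranges over 1..n (as r = suc r' with r' < n); for n ≥ 1 every positive
-- divisor of n lies in this range.
A : (c d n m : ℕ) → ℕ
A c d n m = sum (map (countJ c d n m) (filter (λ r' → suc r' ∣? n) (upTo n)))

module Submission where

-- A(n, m) counts Hermite normal forms.  A pair (r , j) with r ∣ n and
-- 0 ≤ j < r stands for the integer matrix M = ( n/r j ; 0 r ) of determinant
-- n.  Fix γ = ( c -y ; d x ) with x c + y d = 1 (possible as gcd c d = 1).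
-- The first column of M γ is (n/r · c + j d , r d), so its gcd g is the
-- top-left entry of the Hermite form of M γ, whose diagonal is (g , n/g).
-- Sending M to the Hermite form of M γ (top-right entry reduced mod n/g) is
-- an injective, hence bijective, self-map Ψ of the finite set of pairs:
-- if two matrices have the same image, each is a left multiple of the other
-- (right multiplication by γ and left multiplication by unimodular matrices
-- preserve row lattices), which forces equal upper triangular matrices.
-- So A(n, m) is the number of Hermite forms with top-left entry m, i.e.
-- n / m (A-formula states A(n, m) · m = n), and the theorem follows from
-- m = gcd m n₁ · gcd m n₂ (gcd-split).

module IntegerArithmetic where
  open import Data.Integer using (+_; +[1+_]; -[1+_]; 0ℤ; 1ℤ; -_; _+_; _*_; _-_; NonZero)
  open import Data.Integer.Properties
    using (*-cancelˡ-≡; *-identityʳ; *-zeroˡ; +-identityʳ; +-injective; pos-+; pos-*)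
  open import Data.Integer.DivMod using (_%ℕ_; _/ℕ_; a≡a%ℕn+[a/ℕn]*n)
  open import Data.Integer.Tactic.RingSolver using (solve-∀)
  import Data.Nat as ℕ
  import Data.Nat.Properties as ℕ
  open import Data.Empty using (⊥; ⊥-elim)
  open import Relation.Binary.PropositionalEquality

  overshoot : ∀ {a b r} k → a ℕ.< r → + a ≡ + b + +[1+ k ] * + r → ⊥
  overshoot {a} {b} {r} k a<r eq = ℕ.<⇒≱ a<r (begin
    r                     ≤⟨ ℕ.m≤n*m r (ℕ.suc k) ⟩
    ℕ.suc k ℕ.* r         ≤⟨ ℕ.m≤n+m _ b ⟩
    b ℕ.+ ℕ.suc k ℕ.* r   ≡⟨ +-injective lifted ⟨
    a                     ∎)
    where
    open ℕ.≤-Reasoning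
    lifted : + a ≡ + (b ℕ.+ ℕ.suc k ℕ.* r)
    lifted = trans eq (sym (trans (pos-+ b _) (cong (_+_ (+ b)) (pos-* (ℕ.suc k) r))))

  residue-unique : ∀ {j₁ j₂ r} v → j₁ ℕ.< r → j₂ ℕ.< r → + j₂ ≡ + j₁ + v * + r → j₁ ≡ j₂
  residue-unique {j₁} {j₂} {r} (+ 0) _ _ eq = sym (+-injective (begin
    + j₂              ≡⟨ eq ⟩
    + j₁ + 0ℤ * + r   ≡⟨ cong (_+_ (+ j₁)) (*-zeroˡ (+ r)) ⟩
    + j₁ + 0ℤ         ≡⟨ +-identityʳ (+ j₁) ⟩
    + j₁              ∎))
    where open ≡-Reasoning
  residue-unique {j₁} {j₂} (+[1+ k ]) _ j₂<r eq = ⊥-elim (overshoot k j₂<r eq)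
  residue-unique {j₁} {j₂} {r} -[1+ k ] j₁<r _ eq = ⊥-elim (overshoot k j₁<r (begin
    + j₁                                        ≡⟨ move (+ j₁) +[1+ k ] (+ r) ⟩
    + j₁ + - +[1+ k ] * + r + +[1+ k ] * + r   ≡⟨ cong (_+ +[1+ k ] * + r) (sym eq) ⟩
    + j₂ + +[1+ k ] * + r                       ∎))
    where
    open ≡-Reasoning
    move : ∀ J K R → J ≡ J + - K * R + K * R
    move = solve-∀

  bezout-cofactors : ∀ {g p q P Q α β} .{{_ : NonZero g}} → g * p ≡ P → g * q ≡ Q →
                     α * P + β * Q ≡ g → α * p + β * q ≡ 1ℤ
  bezout-cofactors {g} {p} {q} {α = α} {β} refl refl αP+βQ≡g = *-cancelˡ-≡ g _ 1ℤ (begin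
    g * (α * p + β * q)         ≡⟨ factor g α β p q ⟩
    α * (g * p) + β * (g * q)   ≡⟨ αP+βQ≡g ⟩
    g                           ≡⟨ *-identityʳ g ⟨
    g * 1ℤ                      ∎)
    where
    open ≡-Reasoning
    factor : ∀ g α β p q → g * (α * p + β * q) ≡ α * (g * p) + β * (g * q)
    factor = solve-∀

  same-residue : ∀ a b K .{{_ : ℕ.NonZero K}} → a %ℕ K ≡ b %ℕ K → b ≡ a + (b /ℕ K - a /ℕ K) * + K
  same-residue a b K residues≡ = begin
    b                                                 ≡⟨ a≡a%ℕn+[a/ℕn]*n b K ⟩
    + (b %ℕ K) + (b /ℕ K) * + K                       ≡⟨ cong (λ t → + t + (b /ℕ K) * + K) residues≡ ⟨
    + (a %ℕ K) + (b /ℕ K) * + K                       ≡⟨ regroup (+ (a %ℕ K)) (a /ℕ K) (b /ℕ K) (+ K) ⟩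
    + (a %ℕ K) + (a /ℕ K) * + K + (b /ℕ K - a /ℕ K) * + K ≡⟨ cong (_+ (b /ℕ K - a /ℕ K) * + K) (a≡a%ℕn+[a/ℕn]*n a K) ⟨
    a + (b /ℕ K - a /ℕ K) * + K                       ∎
    where
    open ≡-Reasoning
    regroup : ∀ ρ q₁ q₂ K → ρ + q₂ * K ≡ ρ + q₁ * K + (q₂ - q₁) * K
    regroup = solve-∀

open IntegerArithmetic

module IntegerMatrices where
  open import Data.Integer using (ℤ; 0ℤ; 1ℤ; -_; _+_; _*_; _-_; ∣_∣; NonZero)
  open import Data.Integer.Properties
    using (*-cancelʳ-≡; *-cancelˡ-≡; *-identityˡ; *-identityʳ; *-zeroˡ; *-zeroʳ; +-identityˡ; +-identityʳ; abs-*)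
  open import Data.Integer.Divisibility using (_∣_; divides)
  open import Data.Integer.Tactic.RingSolver using (solve-∀)
  open import Data.Product using (∃; _×_; _,_)
  open import Relation.Binary.PropositionalEquality

  record Mat : Set where
    constructor mat
    field e₁₁ e₁₂ e₂₁ e₂₂ : ℤ

  infixl 7 _⊗_
  _⊗_ : Mat → Mat → Mat
  mat a b c d ⊗ mat a′ b′ c′ d′ =
    mat (a * a′ + b * c′) (a * b′ + b * d′) (c * a′ + d * c′) (c * b′ + d * d′)

  I : Mat
  I = mat 1ℤ 0ℤ 0ℤ 1ℤ

  mat-cong : ∀ {a b c d a′ b′ c′ d′} → a ≡ a′ → b ≡ b′ → c ≡ c′ → d ≡ d′ →
             mat a b c d ≡ mat a′ b′ c′ d′
  mat-cong refl refl refl refl = refl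

  private
    row-matrix-column : ∀ u v a b c d s t →
      (u * a + v * c) * s + (u * b + v * d) * t ≡ u * (a * s + b * t) + v * (c * s + d * t)
    row-matrix-column = solve-∀

  ⊗-assoc : ∀ L M N → (L ⊗ M) ⊗ N ≡ L ⊗ (M ⊗ N)
  ⊗-assoc (mat a b c d) (mat a′ b′ c′ d′) (mat a″ b″ c″ d″) =
    mat-cong (row-matrix-column a b a′ b′ c′ d′ a″ c″) (row-matrix-column a b a′ b′ c′ d′ b″ d″)
             (row-matrix-column c d a′ b′ c′ d′ a″ c″) (row-matrix-column c d a′ b′ c′ d′ b″ d″)

  private
    pick₁ˡ : ∀ a c → 1ℤ * a + 0ℤ * c ≡ a
    pick₁ˡ = solve-∀
    pick₂ˡ : ∀ a c → 0ℤ * a + 1ℤ * c ≡ c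
    pick₂ˡ = solve-∀
    pick₁ʳ : ∀ a b → a * 1ℤ + b * 0ℤ ≡ a
    pick₁ʳ = solve-∀
    pick₂ʳ : ∀ a b → a * 0ℤ + b * 1ℤ ≡ b
    pick₂ʳ = solve-∀

  ⊗-identityˡ : ∀ M → I ⊗ M ≡ M
  ⊗-identityˡ (mat a b c d) = mat-cong (pick₁ˡ a c) (pick₁ˡ b d) (pick₂ˡ a c) (pick₂ˡ b d)

  ⊗-identityʳ : ∀ M → M ⊗ I ≡ M
  ⊗-identityʳ (mat a b c d) = mat-cong (pick₁ʳ a b) (pick₂ʳ a b) (pick₁ʳ c d) (pick₂ʳ c d)

  -- N ≼ M: N is a left multiple of M, i.e. the rows of N lie in the
  -- lattice spanned by the rows of M.
  infix 4 _≼_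
  _≼_ : Mat → Mat → Set
  N ≼ M = ∃ λ C → N ≡ C ⊗ M

  ≼-trans : ∀ {L M N} → L ≼ M → M ≼ N → L ≼ N
  ≼-trans {N = N} (C , refl) (D , refl) = C ⊗ D , sym (⊗-assoc C D N)

  ≼-cancelʳ : ∀ {M N G G⁻¹} → G ⊗ G⁻¹ ≡ I → N ⊗ G ≼ M ⊗ G → N ≼ M
  ≼-cancelʳ {M} {N} {G} {G⁻¹} inverse (C , NG≡CMG) = C , (begin
    N                   ≡⟨ sym (⊗-identityʳ N) ⟩
    N ⊗ I               ≡⟨ cong (N ⊗_) (sym inverse) ⟩
    N ⊗ (G ⊗ G⁻¹)       ≡⟨ sym (⊗-assoc N G G⁻¹) ⟩
    N ⊗ G ⊗ G⁻¹         ≡⟨ cong (_⊗ G⁻¹) NG≡CMG ⟩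
    C ⊗ (M ⊗ G) ⊗ G⁻¹   ≡⟨ ⊗-assoc C (M ⊗ G) G⁻¹ ⟩
    C ⊗ (M ⊗ G ⊗ G⁻¹)   ≡⟨ cong (C ⊗_) (⊗-assoc M G G⁻¹) ⟩
    C ⊗ (M ⊗ (G ⊗ G⁻¹)) ≡⟨ cong (λ X → C ⊗ (M ⊗ X)) inverse ⟩
    C ⊗ (M ⊗ I)         ≡⟨ cong (C ⊗_) (⊗-identityʳ M) ⟩
    C ⊗ M               ∎)
    where open ≡-Reasoning

  ≼-invertibleˡ : ∀ {M V W} → W ⊗ V ≡ I → M ≼ V ⊗ M
  ≼-invertibleˡ {M} {V} {W} inverse = W , (begin
    M           ≡⟨ sym (⊗-identityˡ M) ⟩
    I ⊗ M       ≡⟨ cong (_⊗ M) (sym inverse) ⟩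
    W ⊗ V ⊗ M   ≡⟨ ⊗-assoc W V M ⟩
    W ⊗ (V ⊗ M) ∎)
    where open ≡-Reasoning

  infix 4 _∼_
  _∼_ : Mat → Mat → Set
  M ∼ N = M ≼ N × N ≼ M

  upper : ℤ → ℤ → ℤ → Mat
  upper a j r = mat a j 0ℤ r

  shear : ∀ g t R k → upper g (t + k * R) R ≼ upper g t R
  shear g t R k = mat 1ℤ k 0ℤ 1ℤ , mat-cong (sym (corner-entry g k)) (sym (shear-entry t k R))
                                            (sym (zero-entry g)) (sym (pick₂ˡ t R))
    where
    corner-entry : ∀ g k → 1ℤ * g + k * 0ℤ ≡ g
    corner-entry = solve-∀
    shear-entry : ∀ t k R → 1ℤ * t + k * R ≡ t + k * R
    shear-entry = solve-∀
    zero-entry : ∀ g → 0ℤ * g + 1ℤ * 0ℤ ≡ 0ℤ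
    zero-entry = solve-∀

  triangular-≼ : ∀ {a₁ j₁ r₁ a₂ j₂ r₂} .{{_ : NonZero a₁}} → upper a₂ j₂ r₂ ≼ upper a₁ j₁ r₁ →
                 r₁ ∣ r₂ × (a₂ ≡ a₁ → ∃ λ v → j₂ ≡ j₁ + v * r₁)
  triangular-≼ {a₁} {j₁} {r₁} {a₂} {j₂} {r₂} (mat u v w z , eq) =
    divides ∣ z ∣ (trans (cong ∣_∣ r₂≡zr₁) (abs-* z r₁)) , same-corner
    where
    open ≡-Reasoning
    drop-zero : ∀ x y → x + y * 0ℤ ≡ x
    drop-zero x y = trans (cong (_+_ x) (*-zeroʳ y)) (+-identityʳ x)

    w≡0 : w ≡ 0ℤ
    w≡0 = *-cancelʳ-≡ w 0ℤ a₁ (begin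
      w * a₁            ≡⟨ sym (drop-zero (w * a₁) z) ⟩
      w * a₁ + z * 0ℤ   ≡⟨ sym (cong Mat.e₂₁ eq) ⟩
      0ℤ                ≡⟨ sym (*-zeroˡ a₁) ⟩
      0ℤ * a₁           ∎)

    r₂≡zr₁ : r₂ ≡ z * r₁
    r₂≡zr₁ = begin
      r₂                ≡⟨ cong Mat.e₂₂ eq ⟩
      w * j₁ + z * r₁   ≡⟨ cong (λ t → t * j₁ + z * r₁) w≡0 ⟩
      0ℤ * j₁ + z * r₁  ≡⟨ cong (_+ z * r₁) (*-zeroˡ j₁) ⟩
      0ℤ + z * r₁       ≡⟨ +-identityˡ (z * r₁) ⟩
      z * r₁            ∎

    same-corner : a₂ ≡ a₁ → ∃ λ v → j₂ ≡ j₁ + v * r₁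
    same-corner refl = v , (begin
      j₂                ≡⟨ cong Mat.e₁₂ eq ⟩
      u * j₁ + v * r₁   ≡⟨ cong (λ t → t * j₁ + v * r₁) u≡1 ⟩
      1ℤ * j₁ + v * r₁  ≡⟨ cong (_+ v * r₁) (*-identityˡ j₁) ⟩
      j₁ + v * r₁       ∎)
      where
      u≡1 : u ≡ 1ℤ
      u≡1 = *-cancelʳ-≡ u 1ℤ a₁ (begin
        u * a₁            ≡⟨ sym (drop-zero (u * a₁) v) ⟩
        u * a₁ + v * 0ℤ   ≡⟨ sym (cong Mat.e₁₁ eq) ⟩
        a₂                ≡⟨ sym (*-identityˡ a₂) ⟩
        1ℤ * a₁           ∎)

  bezoutMatrix adjugate : ℤ → ℤ → ℤ → ℤ → Mat
  bezoutMatrix α β p q = mat α β (- q) p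
  adjugate α β p q = mat p (- β) q α

  adjugate-inverse : ∀ α β p q → α * p + β * q ≡ 1ℤ → adjugate α β p q ⊗ bezoutMatrix α β p q ≡ I
  adjugate-inverse α β p q det≡1 =
    mat-cong (trans (diagonal α β p q) det≡1) (off-diagonal p β) (off-diagonal′ q α)
             (trans (diagonal′ α β p q) det≡1)
    where
    diagonal : ∀ α β p q → p * α + (- β) * (- q) ≡ α * p + β * q
    diagonal = solve-∀
    diagonal′ : ∀ α β p q → q * β + α * p ≡ α * p + β * q
    diagonal′ = solve-∀
    off-diagonal : ∀ p β → p * β + (- β) * p ≡ 0ℤ
    off-diagonal = solve-∀
    off-diagonal′ : ∀ q α → q * α + α * (- q) ≡ 0ℤ
    off-diagonal′ = solve-∀

  private
    top-left : ∀ α β g p q c → α * (g * p) + β * (0ℤ * c + g * q) ≡ g * (α * p + β * q)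
    top-left = solve-∀
    bottom-left : ∀ p q g c → (- q) * (g * p) + p * (0ℤ * c + g * q) ≡ 0ℤ
    bottom-left = solve-∀
    top-right : ∀ α β a j r x y → α * (a * - y + j * x) + β * (0ℤ * - y + r * x)
                                ≡ α * (j * x - a * y) + β * (r * x)
    top-right = solve-∀
    bottom-right₁ : ∀ g p q a j r x y → g * ((- q) * (a * - y + j * x) + p * (0ℤ * - y + r * x))
                                      ≡ (- (g * q)) * (a * - y + j * x) + (g * p) * (r * x)
    bottom-right₁ = solve-∀
    bottom-right₂ : ∀ a j r c d x y → (- (r * d)) * (a * - y + j * x) + (a * c + j * d) * (r * x)
                                    ≡ (a * r) * (x * c + y * d)
    bottom-right₂ = solve-∀

  -- Change of basis by γ = ( c -y ; d x ), an invertible matrix whenever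
  -- x c + y d = 1.  For an upper triangular M = ( a j ; 0 r ) the first
  -- column of M ⊗ γ is (a c + j d , r d), so the Hermite form of M ⊗ γ has
  -- top-left entry gcd (a c + j d) (r d).
  module ChangeOfBasis (c d x y : ℤ) (xc+yd≡1 : x * c + y * d ≡ 1ℤ) where

    γ γ⁻¹ : Mat
    γ   = adjugate x y c d
    γ⁻¹ = bezoutMatrix x y c d

    γ-inverse : γ ⊗ γ⁻¹ ≡ I
    γ-inverse = adjugate-inverse x y c d xc+yd≡1

    -- Top-right entry of the Hermite form of ( a j ; 0 r ) ⊗ γ, computed
    -- from Bézout coefficients α, β for its first column.
    corner : ℤ → ℤ → ℤ → ℤ → ℤ → ℤ
    corner α β a j r = α * (j * x - a * y) + β * (r * x)

    reduction : ∀ {a j r g p q α β R} .{{_ : NonZero g}} →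
                g * p ≡ a * c + j * d → g * q ≡ r * d → α * p + β * q ≡ 1ℤ → a * r ≡ g * R →
                bezoutMatrix α β p q ⊗ (upper a j r ⊗ γ) ≡ upper g (corner α β a j r) R
    reduction {a} {j} {r} {g} {p} {q} {α} {β} {R} gp≡ gq≡ αp+βq≡1 ar≡gR =
      mat-cong e₁₁ (top-right α β a j r x y) e₂₁ e₂₂
      where
      open ≡-Reasoning
      e₁₁ : α * (a * c + j * d) + β * (0ℤ * c + r * d) ≡ g
      e₁₁ = begin
        α * (a * c + j * d) + β * (0ℤ * c + r * d) ≡⟨ cong₂ (λ P Q → α * P + β * (0ℤ * c + Q)) (sym gp≡) (sym gq≡) ⟩
        α * (g * p) + β * (0ℤ * c + g * q)         ≡⟨ top-left α β g p q c ⟩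
        g * (α * p + β * q)                        ≡⟨ cong (g *_) αp+βq≡1 ⟩
        g * 1ℤ                                     ≡⟨ *-identityʳ g ⟩
        g                                          ∎
      e₂₁ : (- q) * (a * c + j * d) + p * (0ℤ * c + r * d) ≡ 0ℤ
      e₂₁ = begin
        (- q) * (a * c + j * d) + p * (0ℤ * c + r * d) ≡⟨ cong₂ (λ P Q → (- q) * P + p * (0ℤ * c + Q)) (sym gp≡) (sym gq≡) ⟩
        (- q) * (g * p) + p * (0ℤ * c + g * q)         ≡⟨ bottom-left p q g c ⟩
        0ℤ                                             ∎
      e₂₂ : (- q) * (a * - y + j * x) + p * (0ℤ * - y + r * x) ≡ R
      e₂₂ = *-cancelˡ-≡ g _ R (begin
        g * ((- q) * (a * - y + j * x) + p * (0ℤ * - y + r * x)) ≡⟨ bottom-right₁ g p q a j r x y ⟩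
        (- (g * q)) * (a * - y + j * x) + (g * p) * (r * x)      ≡⟨ cong₂ (λ Q P → (- Q) * (a * - y + j * x) + P * (r * x)) gq≡ gp≡ ⟩
        (- (r * d)) * (a * - y + j * x) + (a * c + j * d) * (r * x) ≡⟨ bottom-right₂ a j r c d x y ⟩
        (a * r) * (x * c + y * d)                                ≡⟨ cong₂ _*_ ar≡gR xc+yd≡1 ⟩
        (g * R) * 1ℤ                                             ≡⟨ *-identityʳ (g * R) ⟩
        g * R                                                    ∎)

    reduction-∼ : ∀ {a j r g p q α β R} .{{_ : NonZero g}} →
                  g * p ≡ a * c + j * d → g * q ≡ r * d → α * p + β * q ≡ 1ℤ → a * r ≡ g * R →
                  upper a j r ⊗ γ ∼ upper g (corner α β a j r) R
    reduction-∼ {a} {j} {r} {g} {p} {q} {α} {β} {R} gp≡ gq≡ αp+βq≡1 ar≡gR =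
      subst (_ ≼_) H≡ (≼-invertibleˡ {upper a j r ⊗ γ} {bezoutMatrix α β p q} {adjugate α β p q}
                                      (adjugate-inverse α β p q αp+βq≡1)) ,
      (bezoutMatrix α β p q , sym H≡)
      where
      H≡ : bezoutMatrix α β p q ⊗ (upper a j r ⊗ γ) ≡ upper g (corner α β a j r) R
      H≡ = reduction {a} {j} {r} {g} {p} {q} {α} {β} {R} gp≡ gq≡ αp+βq≡1 ar≡gR

    comparison : ∀ {M₁ M₂ g t₁ t₂ R} k → M₁ ⊗ γ ∼ upper g t₁ R → M₂ ⊗ γ ∼ upper g t₂ R →
                 t₂ ≡ t₁ + k * R → M₂ ≼ M₁
    comparison {g = g} {t₁} {R = R} k (_ , H₁≼M₁γ) (M₂γ≼H₂ , _) refl =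
      ≼-cancelʳ γ-inverse (≼-trans M₂γ≼H₂ (≼-trans (shear g t₁ R k) H₁≼M₁γ))

open IntegerMatrices

open import Defs
open import Data.Nat
  using (ℕ; suc; pred; _+_; _*_; _/_; _<_; _≤_; _≟_; z≤n; s≤s; NonZero; >-nonZero; ≢-nonZero; ≢-nonZero⁻¹)
open import Data.Nat.Properties
  using (+-identityʳ; +-suc; ≤-antisym; +-cancelʳ-≤; +-monoʳ-≤; ≤-trans; ≤-reflexive; *-comm; *-assoc;
         *-identityʳ; *-cancelʳ-≡; suc-injective; suc-pred; m*n≢0; m*n≢0⇒m≢0; m*n≢0⇒n≢0; m<n⇒0<n;
         [m*n]*[o*p]≡[m*o]*[n*p])
open import Data.Nat.Divisibility
  using (_∣_; _∣?_; divides; ∣⇒≤; ∣-trans; ∣-antisym; ∣m+n∣m⇒∣n; ∣n⇒∣m*n; ∣1⇒≡1; *-monoʳ-∣; *-cancelˡ-∣;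
         module ∣-Reasoning)
open import Data.Nat.DivMod using (m/n*n≡m; m*[n/m]≡n; m*n/n≡m)
open import Data.Nat.GCD
  using (gcd; gcd-GCD; gcd[m,n]∣m; gcd[m,n]∣n; gcd-greatest; gcd[m,n]≡0⇒n≡0; c*gcd[m,n]≡gcd[cm,cn];
         module Bézout)
open import Data.Nat.Coprimality using (Coprime; coprime-divisor; coprime-/gcd)
import Data.Nat.Tactic.RingSolver as ℕ-Ring
open import Data.Nat.ListAction using (sum)
open import Data.Integer using (ℤ; +_; 1ℤ; -_) renaming (_+_ to _+ᶻ_; _*_ to _*ᶻ_; _-_ to _-ᶻ_)
open import Data.Integer.Properties using (pos-+; pos-*)
open import Data.Integer.DivMod using (_%ℕ_; _/ℕ_; n%ℕd<d)
open import Data.Integer.Tactic.RingSolver using (solve-∀)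
open import Data.List using (List; []; _∷_; length; filter; map; upTo; _++_)
open import Data.List.Properties using (filter-++; filter-all; filter-none; length-++; length-upTo)
open import Data.List.Relation.Unary.Any using (here; there)
import Data.List.Relation.Unary.All as All
open import Data.List.Relation.Unary.Unique.Propositional using (Unique; []; _∷_)
import Data.List.Relation.Unary.Unique.Propositional.Properties as Unique
open import Data.List.Membership.Propositional using (_∈_)
open import Data.List.Membership.Propositional.Properties
  using (∈-map⁺; ∈-map⁻; ∈-++⁺ˡ; ∈-++⁺ʳ; ∈-++⁻; ∈-upTo⁺; ∈-upTo⁻; ∈-filter⁺; ∈-filter⁻)
open import Data.Product using (∃₂; _×_; _,_; proj₁; proj₂)
open import Data.Product.Properties using (≡-dec)
open import Data.Sum using (inj₁; inj₂)
open import Data.Empty using (⊥)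
open import Function using (_∘_)
open import Level using (0ℓ)
open import Relation.Binary.Definitions using (DecidableEquality)
open import Relation.Binary.PropositionalEquality
open import Relation.Nullary using (yes; no; ¬?; contradiction)
open import Relation.Unary using (Pred; Decidable)

module _ {X : Set} where

  module _ (_≟_ : DecidableEquality X) where

    remove : X → List X → List X
    remove x [] = []
    remove x (y ∷ ys) with x ≟ y
    ... | yes _ = ys
    ... | no _  = y ∷ remove x ys

    length-remove : ∀ {x ys} → x ∈ ys → suc (length (remove x ys)) ≡ length ys
    length-remove {x} {y ∷ ys} x∈ with x ≟ y | x∈
    ... | yes _  | _         = refl
    ... | no x≢y | here x≡y  = contradiction x≡y x≢y
    ... | no _   | there x∈′ = cong suc (length-remove x∈′)

    ∈-remove : ∀ {x z ys} → z ∈ ys → z ≢ x → z ∈ remove x ys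
    ∈-remove {x} {z} {y ∷ ys} z∈ z≢x with x ≟ y | z∈
    ... | yes x≡y | here z≡y  = contradiction (trans z≡y (sym x≡y)) z≢x
    ... | yes _   | there z∈′ = z∈′
    ... | no _    | here z≡y  = here z≡y
    ... | no _    | there z∈′ = there (∈-remove z∈′ z≢x)

    injection-length : ∀ {Y : Set} {xs : List Y} {ys : List X} (f : Y → X) → Unique xs →
                       (∀ {x} → x ∈ xs → f x ∈ ys) →
                       (∀ {x x′} → x ∈ xs → x′ ∈ xs → f x ≡ f x′ → x ≡ x′) →
                       length xs ≤ length ys
    injection-length {xs = []} f _ _ _ = z≤n
    injection-length {xs = x ∷ xs} {ys} f (x∉xs ∷ unique) into inj =
      subst (suc (length xs) ≤_) (length-remove (into (here refl)))
        (s≤s (injection-length f unique into′ (λ z∈ z′∈ → inj (there z∈) (there z′∈))))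
      where
      distinct : ∀ {z} → z ∈ xs → f z ≢ f x
      distinct z∈ fz≡fx = All.lookup x∉xs z∈ (sym (inj (there z∈) (here refl) fz≡fx))
      into′ : ∀ {z} → z ∈ xs → f z ∈ remove (f x) ys
      into′ z∈ = ∈-remove (into (there z∈)) (distinct z∈)

  length-filter-complement : {P : Pred X 0ℓ} (P? : Decidable P) (xs : List X) →
    length (filter P? xs) + length (filter (¬? ∘ P?) xs) ≡ length xs
  length-filter-complement P? [] = refl
  length-filter-complement P? (x ∷ xs) with P? x
  ... | yes _ = cong suc (length-filter-complement P? xs)
  ... | no _  = trans (+-suc _ _) (cong suc (length-filter-complement P? xs))

  -- Counting is invariant under a self-map of a finite set that is
  -- injective: the number of x with P (Ψ x) equals the number of x with P x.
  -- (Each count is at most the other by injection-length, applied to P and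
  -- to its complement, and the two complementary counts add up to the same
  -- total.)
  module _ (_≟_ : DecidableEquality X) {xs : List X} (unique : Unique xs) (Ψ : X → X)
           (into : ∀ {x} → x ∈ xs → Ψ x ∈ xs)
           (inj : ∀ {x x′} → x ∈ xs → x′ ∈ xs → Ψ x ≡ Ψ x′ → x ≡ x′) where

    private
      count-≤ : {Q : Pred X 0ℓ} (Q? : Decidable Q) →
                length (filter (Q? ∘ Ψ) xs) ≤ length (filter Q? xs)
      count-≤ Q? = injection-length _≟_ Ψ (Unique.filter⁺ (Q? ∘ Ψ) unique)
        (λ x∈ → let (x∈xs , Qψx) = ∈-filter⁻ (Q? ∘ Ψ) x∈ in ∈-filter⁺ Q? (into x∈xs) Qψx)
        (λ x∈ x′∈ → inj (proj₁ (∈-filter⁻ (Q? ∘ Ψ) x∈)) (proj₁ (∈-filter⁻ (Q? ∘ Ψ) x′∈)))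

    count-invariant : {P : Pred X 0ℓ} (P? : Decidable P) →
                      length (filter (P? ∘ Ψ) xs) ≡ length (filter P? xs)
    count-invariant P? = ≤-antisym (count-≤ P?)
      (+-cancelʳ-≤ _ _ _ (≤-trans (+-monoʳ-≤ (length (filter P? xs)) (count-≤ (¬? ∘ P?)))
        (≤-reflexive (trans (length-filter-complement P? xs)
                            (sym (length-filter-complement (P? ∘ Ψ) xs))))))

  length-filter-map : ∀ {Y : Set} {P : Pred X 0ℓ} (P? : Decidable P) (f : Y → X) (ys : List Y) →
                      length (filter P? (map f ys)) ≡ length (filter (P? ∘ f) ys)
  length-filter-map P? f [] = refl
  length-filter-map P? f (y ∷ ys) with P? (f y)
  ... | yes _ = cong suc (length-filter-map P? f ys)
  ... | no _  = length-filter-map P? f ys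

  count-cong : {P Q : Pred X 0ℓ} (P? : Decidable P) (Q? : Decidable Q) (xs : List X) →
               (∀ {x} → x ∈ xs → P x → Q x) → (∀ {x} → x ∈ xs → Q x → P x) →
               length (filter P? xs) ≡ length (filter Q? xs)
  count-cong P? Q? [] _ _ = refl
  count-cong P? Q? (x ∷ xs) P⇒Q Q⇒P with P? x | Q? x
  ... | yes _  | yes _  = cong suc (count-cong P? Q? xs (P⇒Q ∘ there) (Q⇒P ∘ there))
  ... | no _   | no _   = count-cong P? Q? xs (P⇒Q ∘ there) (Q⇒P ∘ there)
  ... | yes Px | no ¬Qx = contradiction (P⇒Q (here refl) Px) ¬Qx
  ... | no ¬Px | yes Qx = contradiction (Q⇒P (here refl) Qx) ¬Px

  sum-single : (f : X → ℕ) {xs : List X} {k : X} → Unique xs → k ∈ xs →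
               (∀ {x} → x ∈ xs → x ≢ k → f x ≡ 0) → sum (map f xs) ≡ f k
  sum-single f {x ∷ xs} (x∉xs ∷ _) (here refl) vanish =
    trans (cong (_+_ (f x)) (sum-zero xs (λ z∈ → vanish (there z∈) (λ z≡x → All.lookup x∉xs z∈ (sym z≡x)))))
          (+-identityʳ (f x))
    where
    sum-zero : ∀ ys → (∀ {y} → y ∈ ys → f y ≡ 0) → sum (map f ys) ≡ 0
    sum-zero [] _ = refl
    sum-zero (y ∷ ys) all-zero = cong₂ _+_ (all-zero (here refl)) (sum-zero ys (all-zero ∘ there))
  sum-single f {x ∷ xs} (x∉xs ∷ unique) (there k∈) vanish =
    cong₂ _+_ (vanish (here refl) (λ x≡k → All.lookup x∉xs k∈ x≡k))
              (sum-single f unique k∈ (vanish ∘ there))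

gcd-nonZero : ∀ m n .{{_ : NonZero n}} → NonZero (gcd m n)
gcd-nonZero m n = ≢-nonZero λ gcd≡0 → ≢-nonZero⁻¹ n (gcd[m,n]≡0⇒n≡0 m gcd≡0)

private
  r-times-first : ∀ a r c d j → r * (a * c + j * d) ≡ j * (r * d) + (a * r) * c
  r-times-first = ℕ-Ring.solve-∀
  a-times-second : ∀ a r d → a * (r * d) ≡ (a * r) * d
  a-times-second = ℕ-Ring.solve-∀

-- For n = a r and gcd c d = 1, the gcd g of (a c + j d , r d) divides n:
-- g divides r (a c + j d) - j (r d) = n c and a (r d) = n d.
gcd-divides-index : ∀ a r c d j → gcd c d ≡ 1 → gcd (a * c + j * d) (r * d) ∣ a * r
gcd-divides-index a r c d j gcd[c,d]≡1 = begin
  g                    ∣⟨ gcd-greatest g∣nc g∣nd ⟩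
  gcd (n * c) (n * d)  ≡⟨ c*gcd[m,n]≡gcd[cm,cn] n c d ⟨
  n * gcd c d          ≡⟨ cong (n *_) gcd[c,d]≡1 ⟩
  n * 1                ≡⟨ *-identityʳ n ⟩
  n                    ∎
  where
  open ∣-Reasoning
  n P Q g : ℕ
  n = a * r
  P = a * c + j * d
  Q = r * d
  g = gcd P Q
  g∣nc : g ∣ n * c
  g∣nc = ∣m+n∣m⇒∣n (subst (g ∣_) (r-times-first a r c d j) (∣n⇒∣m*n r (gcd[m,n]∣m P Q)))
                   (∣n⇒∣m*n j (gcd[m,n]∣n P Q))
  g∣nd : g ∣ n * d
  g∣nd = subst (g ∣_) (a-times-second a r d) (∣n⇒∣m*n a (gcd[m,n]∣n P Q))

gcd-split : ∀ m n₁ n₂ .{{_ : NonZero n₁}} → m ∣ n₁ * n₂ → gcd n₁ n₂ ≡ 1 →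
            m ≡ gcd m n₁ * gcd m n₂
gcd-split m n₁ n₂ m∣n₁n₂ gcd[n₁,n₂]≡1 = ∣-antisym m∣m₁m₂ m₁m₂∣m
  where
  m₁ m₂ : ℕ
  m₁ = gcd m n₁
  m₂ = gcd m n₂
  instance
    m₁≢0 : NonZero m₁
    m₁≢0 = gcd-nonZero m n₁
  -- write m = m₁ t and n₁ = m₁ s with t, s coprime
  t s : ℕ
  t = m / m₁
  s = n₁ / m₁
  m₁t≡m : m₁ * t ≡ m
  m₁t≡m = m*[n/m]≡n (gcd[m,n]∣m m n₁)
  m₁s≡n₁ : m₁ * s ≡ n₁
  m₁s≡n₁ = m*[n/m]≡n (gcd[m,n]∣n m n₁)

  -- m₁ ∣ n₁ and m₂ ∣ n₂ are coprime, so m₂ ∣ m₁ t forces m₂ ∣ t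
  m₂∣t : m₂ ∣ t
  m₂∣t = coprime-divisor coprime (subst (m₂ ∣_) (sym m₁t≡m) (gcd[m,n]∣m m n₂))
    where
    coprime : Coprime m₂ m₁
    coprime (i∣m₂ , i∣m₁) = ∣1⇒≡1 (subst (_ ∣_) gcd[n₁,n₂]≡1
      (gcd-greatest (∣-trans i∣m₁ (gcd[m,n]∣n m n₁)) (∣-trans i∣m₂ (gcd[m,n]∣n m n₂))))
  m₁m₂∣m : m₁ * m₂ ∣ m
  m₁m₂∣m = subst (m₁ * m₂ ∣_) m₁t≡m (*-monoʳ-∣ m₁ m₂∣t)

  -- m₁ t ∣ m₁ s n₂ gives t ∣ s n₂, and t is coprime to s, so t ∣ n₂;
  -- as also t ∣ m we get t ∣ m₂
  t∣m₂ : t ∣ m₂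
  t∣m₂ = gcd-greatest (divides m₁ (sym m₁t≡m))
           (coprime-divisor (coprime-/gcd m n₁) (*-cancelˡ-∣ m₁ m₁t∣m₁sn₂))
    where
    m₁t∣m₁sn₂ : m₁ * t ∣ m₁ * (s * n₂)
    m₁t∣m₁sn₂ = subst₂ _∣_ (sym m₁t≡m)
                  (trans (cong (_* n₂) (sym m₁s≡n₁)) (*-assoc m₁ s n₂)) m∣n₁n₂
  m∣m₁m₂ : m ∣ m₁ * m₂
  m∣m₁m₂ = subst (_∣ m₁ * m₂) m₁t≡m (*-monoʳ-∣ m₁ t∣m₂)

-- The pairs (r′ , j) with r′ ∈ rs and j < suc r′: a pair encodes the
-- upper triangular matrix with diagonal (n / suc r′ , suc r′) and top-right
-- entry j.
pairs : List ℕ → List (ℕ × ℕ)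
pairs []        = []
pairs (r′ ∷ rs) = map (r′ ,_) (upTo (suc r′)) ++ pairs rs

∈-pairs⁻ : ∀ {rs r′ j} → (r′ , j) ∈ pairs rs → r′ ∈ rs × j < suc r′
∈-pairs⁻ {r ∷ rs} p∈ with ∈-++⁻ (map (r ,_) (upTo (suc r))) p∈
... | inj₂ p∈rest = let (r′∈ , j<) = ∈-pairs⁻ p∈rest in there r′∈ , j<
... | inj₁ p∈row with ∈-map⁻ (r ,_) p∈row
...   | j , j∈ , refl = here refl , ∈-upTo⁻ j∈

∈-pairs⁺ : ∀ {rs r′ j} → r′ ∈ rs → j < suc r′ → (r′ , j) ∈ pairs rs
∈-pairs⁺ {r ∷ rs} (here refl) j< = ∈-++⁺ˡ (∈-map⁺ (r ,_) (∈-upTo⁺ j<))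
∈-pairs⁺ {r ∷ rs} (there r′∈) j< = ∈-++⁺ʳ (map (r ,_) (upTo (suc r))) (∈-pairs⁺ r′∈ j<)

pairs-unique : ∀ {rs} → Unique rs → Unique (pairs rs)
pairs-unique {[]} [] = []
pairs-unique {r ∷ rs} (r∉rs ∷ unique) =
  Unique.++⁺ (Unique.map⁺ (cong proj₂) (Unique.upTo⁺ (suc r))) (pairs-unique unique) disjoint
  where
  disjoint : ∀ {p} → p ∈ map (r ,_) (upTo (suc r)) × p ∈ pairs rs → ⊥
  disjoint (p∈row , p∈rest) with ∈-map⁻ (r ,_) p∈row
  ... | _ , _ , refl = All.lookup r∉rs (proj₁ (∈-pairs⁻ p∈rest)) refl

count-pairs : {P : Pred (ℕ × ℕ) 0ℓ} (P? : Decidable P) (rs : List ℕ) →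
  length (filter P? (pairs rs)) ≡ sum (map (λ r′ → length (filter (λ j → P? (r′ , j)) (upTo (suc r′)))) rs)
count-pairs P? [] = refl
count-pairs P? (r ∷ rs) = begin
  length (filter P? (row ++ pairs rs))                  ≡⟨ cong length (filter-++ P? row (pairs rs)) ⟩
  length (filter P? row ++ filter P? (pairs rs))        ≡⟨ length-++ (filter P? row) ⟩
  length (filter P? row) + length (filter P? (pairs rs)) ≡⟨ cong₂ _+_ (length-filter-map P? (r ,_) (upTo (suc r)))
                                                                        (count-pairs P? rs) ⟩
  length (filter (λ j → P? (r , j)) (upTo (suc r))) + sum (map count-j rs) ∎
  where
  open ≡-Reasoning
  row : List (ℕ × ℕ)
  row = map (r ,_) (upTo (suc r))
  count-j : ℕ → ℕ
  count-j r′ = length (filter (λ j → P? (r′ , j)) (upTo (suc r′)))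

-- the two sign patterns of Bézout's identity over ℕ, rearranged in ℤ
private
  cancel : ∀ G V K → G +ᶻ V *ᶻ K +ᶻ (- V) *ᶻ K ≡ G
  cancel = solve-∀
  cancel′ : ∀ G U M → (- U) *ᶻ M +ᶻ (G +ᶻ U *ᶻ M) ≡ G
  cancel′ = solve-∀

pos-lin : ∀ a b c d → + (a * b + c * d) ≡ + a *ᶻ + b +ᶻ + c *ᶻ + d
pos-lin a b c d = trans (pos-+ (a * b) (c * d)) (cong₂ _+ᶻ_ (pos-* a b) (pos-* c d))

pos-affine : ∀ g v k → + (g + v * k) ≡ + g +ᶻ + v *ᶻ + k
pos-affine g v k = trans (pos-+ g (v * k)) (cong (+ g +ᶻ_) (pos-* v k))

bezout : ∀ m k → ∃₂ λ α β → α *ᶻ + m +ᶻ β *ᶻ + k ≡ + gcd m k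
bezout m k with Bézout.identity (gcd-GCD m k)
... | Bézout.+- u v eq = + u , - + v , (begin
  + u *ᶻ + m +ᶻ (- + v) *ᶻ + k                   ≡⟨ cong (_+ᶻ (- + v) *ᶻ + k) (sym (pos-* u m)) ⟩
  + (u * m) +ᶻ (- + v) *ᶻ + k                    ≡⟨ cong (λ t → + t +ᶻ (- + v) *ᶻ + k) (sym eq) ⟩
  + (gcd m k + v * k) +ᶻ (- + v) *ᶻ + k          ≡⟨ cong (_+ᶻ (- + v) *ᶻ + k) (pos-affine (gcd m k) v k) ⟩
  + gcd m k +ᶻ + v *ᶻ + k +ᶻ (- + v) *ᶻ + k       ≡⟨ cancel (+ gcd m k) (+ v) (+ k) ⟩
  + gcd m k                                      ∎)
  where open ≡-Reasoning
... | Bézout.-+ u v eq = - + u , + v , (begin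
  (- + u) *ᶻ + m +ᶻ + v *ᶻ + k                   ≡⟨ cong ((- + u) *ᶻ + m +ᶻ_) (sym (pos-* v k)) ⟩
  (- + u) *ᶻ + m +ᶻ + (v * k)                    ≡⟨ cong (λ t → (- + u) *ᶻ + m +ᶻ + t) (sym eq) ⟩
  (- + u) *ᶻ + m +ᶻ + (gcd m k + u * m)          ≡⟨ cong ((- + u) *ᶻ + m +ᶻ_) (pos-affine (gcd m k) u m) ⟩
  (- + u) *ᶻ + m +ᶻ (+ gcd m k +ᶻ + u *ᶻ + m)     ≡⟨ cancel′ (+ gcd m k) (+ u) (+ m) ⟩
  + gcd m k                                      ∎)
  where open ≡-Reasoning

module HermiteCount (c d : ℕ) {{d≢0 : NonZero d}} (gcd[c,d]≡1 : gcd c d ≡ 1)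
                    (n : ℕ) {{n≢0 : NonZero n}} where

  x y : ℤ
  x = proj₁ (bezout c d)
  y = proj₁ (proj₂ (bezout c d))

  xc+yd≡1 : x *ᶻ + c +ᶻ y *ᶻ + d ≡ 1ℤ
  xc+yd≡1 = trans (proj₂ (proj₂ (bezout c d))) (cong +_ gcd[c,d]≡1)

  open ChangeOfBasis (+ c) (+ d) x y xc+yd≡1
  open ≡-Reasoning

  divisors : List ℕ
  divisors = filter (λ r′ → suc r′ ∣? n) (upTo n)

  S : List (ℕ × ℕ)
  S = pairs divisors

  ∈S⁻ : ∀ {r′ j} → (r′ , j) ∈ S → suc r′ ∣ n × j < suc r′
  ∈S⁻ p∈ = let (r′∈ , j<) = ∈-pairs⁻ {divisors} p∈ in proj₂ (∈-filter⁻ (λ r′ → suc r′ ∣? n) {xs = upTo n} r′∈) , j<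

  ∈S⁺ : ∀ {r′ j} → suc r′ ∣ n → j < suc r′ → (r′ , j) ∈ S
  ∈S⁺ r∣n j< = ∈-pairs⁺ (∈-filter⁺ (λ r′ → suc r′ ∣? n) (∈-upTo⁺ (∣⇒≤ r∣n)) r∣n) j<

  S-unique : Unique S
  S-unique = pairs-unique (Unique.filter⁺ (λ r′ → suc r′ ∣? n) (Unique.upTo⁺ n))

  -- the matrix of a pair, the first column (P , Q) of its γ-transform and
  -- g = gcd P Q, the top-left entry of the Hermite form of that transform
  a P Q g : ℕ × ℕ → ℕ
  a (r′ , j) = n / suc r′
  P (r′ , j) = a (r′ , j) * c + j * d
  Q (r′ , j) = suc r′ * d
  g p = gcd (P p) (Q p)

  matrix : ℕ × ℕ → Mat
  matrix (r′ , j) = upper (+ a (r′ , j)) (+ j) (+ suc r′)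

  g≢0 : ∀ p → NonZero (g p)
  g≢0 (r′ , j) = gcd-nonZero (P (r′ , j)) (Q (r′ , j)) {{m*n≢0 (suc r′) d}}

  -- the remaining entries of the Hermite form: bottom-right R = n / g and
  -- top-right T, computed from Bézout coefficients α, β for (P , Q)
  R : ℕ × ℕ → ℕ
  R p = _/_ n (g p) {{g≢0 p}}

  α β T : ℕ × ℕ → ℤ
  α p = proj₁ (bezout (P p) (Q p))
  β p = proj₁ (proj₂ (bezout (P p) (Q p)))
  T p = corner (α p) (β p) (+ a p) (+ proj₂ p) (+ suc (proj₁ p))

  -- The reduction map: a pair goes to the pair encoding the Hermite form
  -- of its γ-transform, with top-right entry reduced modulo R.
  Ψ : ℕ × ℕ → ℕ × ℕ
  Ψ p = pred (R p) , T p %ℕ suc (pred (R p))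

  hermite : ℕ → ℤ → Mat
  hermite R′ t = upper (+ (n / suc R′)) t (+ suc R′)

  a*r≡n : ∀ {r′ j} → (r′ , j) ∈ S → a (r′ , j) * suc r′ ≡ n
  a*r≡n p∈ = m/n*n≡m (proj₁ (∈S⁻ p∈))

  a≢0 : ∀ {p} → p ∈ S → NonZero (a p)
  a≢0 {r′ , j} p∈ = m*n≢0⇒m≢0 (a (r′ , j)) {{subst NonZero (sym (a*r≡n p∈)) n≢0}}

  g*R≡n : ∀ {p} → p ∈ S → g p * suc (pred (R p)) ≡ n
  g*R≡n {p@(r′ , j)} p∈ = trans (cong (g p *_) (suc-pred (R p) {{R≢0}})) g*R≡n′
    where
    g∣n : g p ∣ n
    g∣n = subst (g p ∣_) (a*r≡n p∈) (gcd-divides-index (a p) (suc r′) c d j gcd[c,d]≡1)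
    g*R≡n′ : g p * R p ≡ n
    g*R≡n′ = m*[n/m]≡n {{g≢0 p}} g∣n
    R≢0 : NonZero (R p)
    R≢0 = m*n≢0⇒n≢0 (g p) {{subst NonZero (sym g*R≡n′) n≢0}}

  g-image : ∀ {p} → p ∈ S → g p ≡ n / suc (proj₁ (Ψ p))
  g-image {p} p∈ = sym (trans (cong (_/ suc (pred (R p))) (sym (g*R≡n p∈)))
                              (m*n/n≡m (g p) (suc (pred (R p)))))

  Ψ-into : ∀ {p} → p ∈ S → Ψ p ∈ S
  Ψ-into {p} p∈ = ∈S⁺ (divides (g p) (sym (g*R≡n p∈))) (n%ℕd<d (T p) (suc (pred (R p))))

  hermite-∼ : ∀ {p} → p ∈ S → matrix p ⊗ γ ∼ hermite (proj₁ (Ψ p)) (T p)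
  hermite-∼ {p@(r′ , j)} p∈ =
    subst (λ G → matrix p ⊗ γ ∼ upper (+ G) (T p) (+ suc (pred (R p)))) (g-image p∈)
      (reduction-∼ {+ a p} {+ j} {+ suc r′} {+ g p} {+ (P p / g p)} {+ (Q p / g p)} {α p} {β p}
                   {+ suc (pred (R p))} (trans gp≡P (pos-lin (a p) c j d)) (trans gq≡Q (pos-* (suc r′) d))
                   αp+βq≡1 (lift {a p} {suc r′} {g p} (trans (a*r≡n p∈) (sym (g*R≡n p∈)))))
    where
    instance
      g≢0′ : NonZero (g p)
      g≢0′ = g≢0 p
    lift : ∀ {u v w z} → u * v ≡ w * z → + u *ᶻ + v ≡ + w *ᶻ + z
    lift {u} {v} {w} {z} eq = trans (sym (pos-* u v)) (trans (cong +_ eq) (pos-* w z))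
    gp≡P : + g p *ᶻ + (P p / g p) ≡ + P p
    gp≡P = trans (sym (pos-* (g p) _)) (cong +_ (m*[n/m]≡n (gcd[m,n]∣m (P p) (Q p))))
    gq≡Q : + g p *ᶻ + (Q p / g p) ≡ + Q p
    gq≡Q = trans (sym (pos-* (g p) _)) (cong +_ (m*[n/m]≡n (gcd[m,n]∣n (P p) (Q p))))
    αp+βq≡1 : α p *ᶻ + (P p / g p) +ᶻ β p *ᶻ + (Q p / g p) ≡ 1ℤ
    αp+βq≡1 = bezout-cofactors {α = α p} {β p} gp≡P gq≡Q (proj₂ (proj₂ (bezout (P p) (Q p))))

  -- Pairs with the same image: their Hermite forms differ by a shear, so
  -- the matrix of the second pair is a left multiple of that of the first.
  image-≼ : ∀ {p₁ p₂} → p₁ ∈ S → p₂ ∈ S → Ψ p₁ ≡ Ψ p₂ → matrix p₂ ≼ matrix p₁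
  image-≼ {p₁} {p₂} p₁∈ p₂∈ Ψp₁≡Ψp₂ =
    comparison {g = + (n / K)} {T p₁} {T p₂} {+ K} (T p₂ /ℕ K -ᶻ T p₁ /ℕ K) (hermite-∼ p₁∈) H₂
      (same-residue (T p₁) (T p₂) K residues≡)
    where
    K : ℕ
    K = suc (proj₁ (Ψ p₁))
    H₂ : matrix p₂ ⊗ γ ∼ hermite (proj₁ (Ψ p₁)) (T p₂)
    H₂ = subst (λ q → matrix p₂ ⊗ γ ∼ hermite (proj₁ q) (T p₂)) (sym Ψp₁≡Ψp₂) (hermite-∼ p₂∈)
    residues≡ : T p₁ %ℕ K ≡ T p₂ %ℕ K
    residues≡ = trans (cong proj₂ Ψp₁≡Ψp₂) (cong (λ R′ → T p₂ %ℕ suc R′) (sym (cong proj₁ Ψp₁≡Ψp₂)))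

  -- Ψ is injective on S: mutual left multiples among these upper
  -- triangular matrices have the same diagonal (so the same r) and
  -- congruent, hence equal, top-right entries.
  Ψ-injective : ∀ {p₁ p₂} → p₁ ∈ S → p₂ ∈ S → Ψ p₁ ≡ Ψ p₂ → p₁ ≡ p₂
  Ψ-injective {r₁ , j₁} {r₂ , j₂} p₁∈ p₂∈ Ψp₁≡Ψp₂ = cong₂ _,_ r₁≡r₂ j₁≡j₂
    where
    r₁∣r₂ : suc r₁ ∣ suc r₂
    r₁∣r₂ = proj₁ (triangular-≼ {{a≢0 p₁∈}} (image-≼ p₁∈ p₂∈ Ψp₁≡Ψp₂))
    r₂∣r₁ : suc r₂ ∣ suc r₁
    r₂∣r₁ = proj₁ (triangular-≼ {{a≢0 p₂∈}} (image-≼ p₂∈ p₁∈ (sym Ψp₁≡Ψp₂)))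
    r₁≡r₂ : r₁ ≡ r₂
    r₁≡r₂ = suc-injective (∣-antisym r₁∣r₂ r₂∣r₁)
    -- with equal r the top-left entries agree, so j₂ ≡ j₁ modulo suc r₁
    j₁≡j₂ : j₁ ≡ j₂
    j₁≡j₂ =
      let (v , j₂≡j₁+vr) = proj₂ (triangular-≼ {{a≢0 p₁∈}} (image-≼ p₁∈ p₂∈ Ψp₁≡Ψp₂))
                                 (cong (λ r → + (n / suc r)) (sym r₁≡r₂))
      in residue-unique v (proj₂ (∈S⁻ p₁∈)) (subst (λ r → j₂ < suc r) (sym r₁≡r₂) (proj₂ (∈S⁻ p₂∈)))
                        j₂≡j₁+vr

  -- Exactly N of the Hermite forms of determinant n = N m have top-left
  -- entry m: they are those with r = N, and j ranges over [0 , N).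
  top-left-count : ∀ m N .{{_ : NonZero m}} → n ≡ N * m →
                   length (filter (λ q → m ≟ n / suc (proj₁ q)) S) ≡ N
  top-left-count m N n≡Nm = begin
    length (filter (λ q → m ≟ n / suc (proj₁ q)) S) ≡⟨ count-pairs (λ q → m ≟ n / suc (proj₁ q)) divisors ⟩
    sum (map count-j divisors)                      ≡⟨ sum-single count-j (Unique.filter⁺ _ (Unique.upTo⁺ n)) k∈ vanish ⟩
    count-j k                                       ≡⟨ cong length (filter-all (λ _ → m ≟ n / suc k) {upTo (suc k)} (All.universal (λ _ → sym n/N≡m) _)) ⟩
    length (upTo (suc k))                           ≡⟨ length-upTo (suc k) ⟩
    suc k                                           ≡⟨ suc-pred N {{N≢0}} ⟩
    N                                               ∎
    where
    count-j : ℕ → ℕ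
    count-j r′ = length (filter (λ _ → m ≟ n / suc r′) (upTo (suc r′)))
    N≢0 : NonZero N
    N≢0 = m*n≢0⇒m≢0 N {{subst NonZero n≡Nm n≢0}}
    k : ℕ
    k = pred N
    n≡m*N : n ≡ m * suc k
    n≡m*N = trans n≡Nm (trans (cong (_* m) (sym (suc-pred N {{N≢0}}))) (*-comm (suc k) m))
    n/N≡m : n / suc k ≡ m
    n/N≡m = trans (cong (_/ suc k) n≡m*N) (m*n/n≡m m (suc k))
    k∈ : k ∈ divisors
    k∈ = ∈-filter⁺ (λ r′ → suc r′ ∣? n) (∈-upTo⁺ (∣⇒≤ (divides m n≡m*N))) (divides m n≡m*N)
    forced : ∀ {r′} → r′ ∈ divisors → m ≡ n / suc r′ → r′ ≡ k
    forced {r′} r′∈ m≡n/r = cong pred (*-cancelʳ-≡ (suc r′) N m (begin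
      suc r′ * m          ≡⟨ cong (suc r′ *_) m≡n/r ⟩
      suc r′ * (n / suc r′) ≡⟨ m*[n/m]≡n (proj₂ (∈-filter⁻ (λ r′ → suc r′ ∣? n) {xs = upTo n} r′∈)) ⟩
      n                   ≡⟨ n≡Nm ⟩
      N * m               ∎))
    vanish : ∀ {r′} → r′ ∈ divisors → r′ ≢ k → count-j r′ ≡ 0
    vanish {r′} r′∈ r′≢k =
      cong length (filter-none (λ _ → m ≟ n / suc r′) {upTo (suc r′)} (All.universal (λ _ → r′≢k ∘ forced r′∈) _))

  -- A(n, m) counts the pairs whose γ-transform has top-left entry m; via
  -- the bijection Ψ of S this is the number of Hermite forms with
  -- top-left entry m.
  A-count : ∀ m → A c d n m ≡ length (filter (λ q → m ≟ n / suc (proj₁ q)) S)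
  A-count m = begin
    A c d n m                                           ≡⟨ count-pairs (λ p → m ≟ g p) divisors ⟨
    length (filter (λ p → m ≟ g p) S)                   ≡⟨ count-cong _ _ S (λ p∈ m≡g → trans m≡g (g-image p∈))
                                                                            (λ p∈ m≡g → trans m≡g (sym (g-image p∈))) ⟩
    length (filter (λ p → m ≟ n / suc (proj₁ (Ψ p))) S) ≡⟨ count-invariant (≡-dec _≟_ _≟_) S-unique Ψ Ψ-into Ψ-injective
                                                             (λ q → m ≟ n / suc (proj₁ q)) ⟩
    length (filter (λ q → m ≟ n / suc (proj₁ q)) S)     ∎

A-formula : ∀ c d n m {{_ : NonZero d}} {{_ : NonZero n}} {{_ : NonZero m}} →
            gcd c d ≡ 1 → m ∣ n → A c d n m * m ≡ n
A-formula c d n m gcd[c,d]≡1 (divides N n≡Nm) =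
  trans (cong (_* m) (trans (A-count m) (top-left-count m N n≡Nm))) (sym n≡Nm)
  where open HermiteCount c d gcd[c,d]≡1 n

lemma3 : (c d : ℕ) → c < d → gcd c d ≡ 1 →
         (n m n₁ n₂ : ℕ) → 1 ≤ n → 1 ≤ m → m ∣ n →
         1 ≤ n₁ → 1 ≤ n₂ → n ≡ n₁ * n₂ → gcd n₁ n₂ ≡ 1 →
         A c d n m ≡ A c d n₁ (gcd m n₁) * A c d n₂ (gcd m n₂)
lemma3 c d c<d gcd[c,d]≡1 n m n₁ n₂ 0<n 0<m m∣n 0<n₁ 0<n₂ refl gcd[n₁,n₂]≡1 =
  *-cancelʳ-≡ _ _ m (begin
    A c d n m * m                   ≡⟨ A-formula c d n m gcd[c,d]≡1 m∣n ⟩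
    n₁ * n₂                         ≡⟨ cong₂ _*_ (A-formula c d n₁ m₁ gcd[c,d]≡1 (gcd[m,n]∣n m n₁))
                                                 (A-formula c d n₂ m₂ gcd[c,d]≡1 (gcd[m,n]∣n m n₂)) ⟨
    (A₁ * m₁) * (A₂ * m₂)           ≡⟨ [m*n]*[o*p]≡[m*o]*[n*p] A₁ m₁ A₂ m₂ ⟩
    (A₁ * A₂) * (m₁ * m₂)           ≡⟨ cong (A₁ * A₂ *_) (gcd-split m n₁ n₂ m∣n gcd[n₁,n₂]≡1) ⟨
    (A₁ * A₂) * m                   ∎)
  where
  open ≡-Reasoning
  m₁ m₂ A₁ A₂ : ℕ
  m₁ = gcd m n₁
  m₂ = gcd m n₂
  A₁ = A c d n₁ m₁
  A₂ = A c d n₂ m₂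
  instance
    d≢0 : NonZero d
    d≢0 = >-nonZero (m<n⇒0<n c<d)
    n≢0 : NonZero (n₁ * n₂)
    n≢0 = >-nonZero 0<n
    m≢0 : NonZero m
    m≢0 = >-nonZero 0<m
    n₁≢0 : NonZero n₁
    n₁≢0 = >-nonZero 0<n₁
    n₂≢0 : NonZero n₂
    n₂≢0 = >-nonZero 0<n₂
    m₁≢0 : NonZero m₁
    m₁≢0 = gcd-nonZero m n₁
    m₂≢0 : NonZero m₂
    m₂≢0 = gcd-nonZero m n₂
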